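{- Let $P_i=(x_i,x_i^2)$ and $P_j=(x_j,x_j^2)$ be two distinct points on the parabola $y=x^2$ with $x_i,x_j\in\mathbb{Q}$. Then the Euclidean distance between $P_i$ and $P_j$ is rational if and only if $x_i+x_j\in\Psi$, i.e. $x_i+x_j$ is a Pythagorean ratio.
   Context: A Pythagorean triplet is a triple $(\alpha,\beta,\gamma)$ of nonzero integers with $\alpha^2+\beta^2=\gamma^2$ and $\gamma>0$. Its Pythagorean ratio is $\beta/\alpha$. The number $0$ is also counted as a Pythagorean ratio (the zero ratio). Let $\Psi=\{0\}\cup\{\beta/\alpha : (\alpha,\beta,\gamma) \text{ a Pythagorean triplet}\}$ be the set of all Pythagorean ratios. -}

module Defs where

open import Data.Nat using (suc)
open import Data.Integer as ℤ using (ℤ; +_; +[1+_]; -[1+_])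
open import Data.Rational using (ℚ; 0ℚ; _+_; _-_; _*_; _≤_; _/_)
open import Data.Product using (Σ; _×_; ∃-syntax)
open import Data.Sum using (_⊎_)
open import Relation.Binary.PropositionalEquality using (_≡_; _≢_)

Point : Set
Point = ℚ × ℚ

open import Data.Product using (_,_)

sqDist : Point → Point → ℚ
sqDist (a , b) (c , d) = (a - c) * (a - c) + (b - d) * (b - d)

RationalDistance : Point → Point → Set
RationalDistance P Q = ∃[ d ] (0ℚ ≤ d × d * d ≡ sqDist P Q)

onParabola : ℚ → Point
onParabola x = (x , x * x)

-- The rational number β/α for integers β, α (α ≠ 0); the value for
-- α = 0 is irrelevant (never used, since triplets have α ≠ 0).
ratio : ℤ → ℤ → ℚ
ratio β (+ 0)      = 0ℚ
ratio β +[1+ n ]   = β / suc n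
ratio β -[1+ n ]   = (ℤ.- β) / suc n

record PythagoreanTriplet : Set where
  field
    α β γ : ℤ
    α≢0   : α ≢ + 0
    β≢0   : β ≢ + 0
    γ≢0   : γ ≢ + 0
    γ>0   : + 0 ℤ.< γ
    pyth  : α ℤ.* α ℤ.+ β ℤ.* β ≡ γ ℤ.* γ

Ψ : ℚ → Set
Ψ q = q ≡ 0ℚ ⊎ Σ PythagoreanTriplet (λ t → q ≡ ratio (PythagoreanTriplet.β t) (PythagoreanTriplet.α t))

{-# OPTIONS --safe #-}
module Submission where

-- Since x² − y² = (x − y)(x + y), the squared distance of two points of the
-- parabola is (xi − xj)²(1 + s²) with s = xi + xj, so for xi ≠ xj it is a
-- rational square iff 1 + s² = r² is. Clearing the denominators of s and r
-- turns 1 + s² = r² into an integer Pythagorean triplet with ratio s, and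
-- dividing α² + β² = γ² by α² turns a triplet back into 1 + s² = (γ/α)².

open import Defs
open import Data.Rational using (ℚ; _+_)
open import Relation.Binary.PropositionalEquality using (_≢_)
open import Function.Bundles using (_⇔_; mk⇔)
open import Function.Base using (_∘_)
open Function.Bundles.Equivalence using (to; from)

open import Data.Empty using (⊥-elim)
open import Data.Integer as ℤ using (ℤ; +_; +[1+_]; -[1+_])
import Data.Integer.Properties as ℤP
open import Data.Nat as ℕ using (suc)
import Data.Nat.Properties as ℕP
open import Data.Product using (Σ; _×_; _,_; ∃-syntax)
open import Data.Rational using (mkℚ; 0ℚ; 1ℚ; _*_; _-_; -_; 1/_; ∣_∣; _≤_; _<_; _/_; ↥_; ↧_; toℚᵘ; NonZero; NonNegative; Positive; nonNegative; ≢-nonZero)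
import Data.Rational.Properties as QP
open import Algebra.Properties.Group QP.+-0-group using (x∙y⁻¹≈ε⇒x≈y; ⁻¹-involutive)
open import Data.Rational.Solver using (module +-*-Solver)
open import Data.Rational.Unnormalised as ℚᵘ using (mkℚᵘ; *≡*)
import Data.Rational.Unnormalised.Properties as ℚᵘP
open import Data.Sum using (inj₁; inj₂)
open import Function.Construct.Composition using (_⇔-∘_)
open import Relation.Binary.PropositionalEquality
open import Relation.Nullary using (yes; no)

open +-*-Solver using (solve; _:=_; _:+_; _:*_; _:-_; :-_; con)

fromℤ : ℤ → ℚ
fromℤ i = i / 1

toℚᵘ-fromℤ : ∀ i → toℚᵘ (fromℤ i) ℚᵘ.≃ mkℚᵘ i 0
toℚᵘ-fromℤ i = QP.toℚᵘ-fromℚᵘ (mkℚᵘ i 0)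

fromℤ-homo-* : ∀ i j → fromℤ (i ℤ.* j) ≡ fromℤ i * fromℤ j
fromℤ-homo-* i j = QP.toℚᵘ-injective (begin
  toℚᵘ (fromℤ (i ℤ.* j))              ≈⟨ toℚᵘ-fromℤ (i ℤ.* j) ⟩
  mkℚᵘ i 0 ℚᵘ.* mkℚᵘ j 0              ≈⟨ ℚᵘP.*-cong (toℚᵘ-fromℤ i) (toℚᵘ-fromℤ j) ⟨
  toℚᵘ (fromℤ i) ℚᵘ.* toℚᵘ (fromℤ j)  ≈⟨ QP.toℚᵘ-homo-* (fromℤ i) (fromℤ j) ⟨
  toℚᵘ (fromℤ i * fromℤ j)            ∎)
  where open ℚᵘP.≃-Reasoning

fromℤ-homo-+ : ∀ i j → fromℤ (i ℤ.+ j) ≡ fromℤ i + fromℤ j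
fromℤ-homo-+ i j = QP.toℚᵘ-injective (begin
  toℚᵘ (fromℤ (i ℤ.+ j))              ≈⟨ toℚᵘ-fromℤ (i ℤ.+ j) ⟩
  mkℚᵘ (i ℤ.+ j) 0                    ≈⟨ *≡* (cong (ℤ._* + 1) (cong₂ ℤ._+_ (sym (ℤP.*-identityʳ i)) (sym (ℤP.*-identityʳ j)))) ⟩
  mkℚᵘ i 0 ℚᵘ.+ mkℚᵘ j 0              ≈⟨ ℚᵘP.+-cong (toℚᵘ-fromℤ i) (toℚᵘ-fromℤ j) ⟨
  toℚᵘ (fromℤ i) ℚᵘ.+ toℚᵘ (fromℤ j)  ≈⟨ QP.toℚᵘ-homo-+ (fromℤ i) (fromℤ j) ⟨
  toℚᵘ (fromℤ i + fromℤ j)            ∎)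
  where open ℚᵘP.≃-Reasoning

fromℤ-homo-‿- : ∀ i → fromℤ (ℤ.- i) ≡ - fromℤ i
fromℤ-homo-‿- i = QP.toℚᵘ-injective (begin
  toℚᵘ (fromℤ (ℤ.- i))    ≈⟨ toℚᵘ-fromℤ (ℤ.- i) ⟩
  ℚᵘ.- mkℚᵘ i 0           ≈⟨ ℚᵘP.-‿cong (toℚᵘ-fromℤ i) ⟨
  ℚᵘ.- toℚᵘ (fromℤ i)     ≈⟨ QP.toℚᵘ-homo‿- (fromℤ i) ⟨
  toℚᵘ (- fromℤ i)        ∎)
  where open ℚᵘP.≃-Reasoning

fromℤ-injective : ∀ {i j} → fromℤ i ≡ fromℤ j → i ≡ j
fromℤ-injective {i} {j} eq
  with ℚᵘP.≃-trans (ℚᵘP.≃-sym (toℚᵘ-fromℤ i)) (ℚᵘP.≃-trans (QP.toℚᵘ-cong eq) (toℚᵘ-fromℤ j))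
... | *≡* i*1≡j*1 = trans (sym (ℤP.*-identityʳ i)) (trans i*1≡j*1 (ℤP.*-identityʳ j))

fromℤ-≢0 : ∀ {i} → i ≢ + 0 → fromℤ i ≢ 0ℚ
fromℤ-≢0 i≢0 eq = i≢0 (fromℤ-injective eq)

fromℤ-pythagorean : ∀ a b g →
  a ℤ.* a ℤ.+ b ℤ.* b ≡ g ℤ.* g ⇔
  fromℤ a * fromℤ a + fromℤ b * fromℤ b ≡ fromℤ g * fromℤ g
fromℤ-pythagorean a b g = mk⇔
  (λ eq → trans (sym lhs) (trans (cong fromℤ eq) (fromℤ-homo-* g g)))
  (λ eq → fromℤ-injective (trans lhs (trans eq (sym (fromℤ-homo-* g g)))))
  where
  lhs : fromℤ (a ℤ.* a ℤ.+ b ℤ.* b) ≡ fromℤ a * fromℤ a + fromℤ b * fromℤ b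
  lhs = trans (fromℤ-homo-+ (a ℤ.* a) (b ℤ.* b)) (cong₂ _+_ (fromℤ-homo-* a a) (fromℤ-homo-* b b))

/-*-denominator : ∀ i n → (i / suc n) * fromℤ +[1+ n ] ≡ fromℤ i
/-*-denominator i n = QP.toℚᵘ-injective (begin
  toℚᵘ ((i / suc n) * fromℤ +[1+ n ])           ≈⟨ QP.toℚᵘ-homo-* (i / suc n) (fromℤ +[1+ n ]) ⟩
  toℚᵘ (i / suc n) ℚᵘ.* toℚᵘ (fromℤ +[1+ n ])   ≈⟨ ℚᵘP.*-cong (QP.toℚᵘ-fromℚᵘ (mkℚᵘ i n)) (toℚᵘ-fromℤ +[1+ n ]) ⟩
  mkℚᵘ i n ℚᵘ.* mkℚᵘ +[1+ n ] 0                 ≈⟨ *≡* cross ⟩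
  mkℚᵘ i 0                                      ≈⟨ toℚᵘ-fromℤ i ⟨
  toℚᵘ (fromℤ i)                                ∎)
  where
  open ℚᵘP.≃-Reasoning
  cross : (i ℤ.* +[1+ n ]) ℤ.* + 1 ≡ i ℤ.* + (suc n ℕ.* 1)
  cross rewrite ℕP.*-identityʳ (suc n) = ℤP.*-identityʳ (i ℤ.* +[1+ n ])

*-denominator : ∀ p → p * fromℤ (↧ p) ≡ fromℤ (↥ p)
*-denominator p@record{} = subst (λ q → q * fromℤ (↧ p) ≡ fromℤ (↥ p)) (QP.↥p/↧p≡p p) (/-*-denominator (↥ p) _)

ratio-*-denominator : ∀ b a → a ≢ + 0 → ratio b a * fromℤ a ≡ fromℤ b
ratio-*-denominator b (+ 0)      a≢0 = ⊥-elim (a≢0 refl)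
ratio-*-denominator b +[1+ n ]   _   = /-*-denominator b n
ratio-*-denominator b -[1+ n ]   _   = begin
  ((ℤ.- b) / suc n) * fromℤ (ℤ.- +[1+ n ])      ≡⟨ cong (((ℤ.- b) / suc n) *_) (fromℤ-homo-‿- +[1+ n ]) ⟩
  ((ℤ.- b) / suc n) * - fromℤ +[1+ n ]          ≡⟨ QP.neg-distribʳ-* ((ℤ.- b) / suc n) (fromℤ +[1+ n ]) ⟨
  - (((ℤ.- b) / suc n) * fromℤ +[1+ n ])        ≡⟨ cong -_ (/-*-denominator (ℤ.- b) n) ⟩
  - fromℤ (ℤ.- b)                               ≡⟨ cong -_ (fromℤ-homo-‿- b) ⟩
  - - fromℤ b                                   ≡⟨ ⁻¹-involutive (fromℤ b) ⟩
  fromℤ b                                       ∎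
  where open ≡-Reasoning

*-cancelʳ-≡ : ∀ {p q} r → r ≢ 0ℚ → p * r ≡ q * r → p ≡ q
*-cancelʳ-≡ {p} {q} r r≢0 pr≡qr = begin
  p                  ≡⟨ QP.*-identityʳ p ⟨
  p * 1ℚ             ≡⟨ cong (p *_) (QP.*-inverseʳ r) ⟨
  p * (r * 1/ r)     ≡⟨ QP.*-assoc p r (1/ r) ⟨
  (p * r) * 1/ r     ≡⟨ cong (_* 1/ r) pr≡qr ⟩
  (q * r) * 1/ r     ≡⟨ QP.*-assoc q r (1/ r) ⟩
  q * (r * 1/ r)     ≡⟨ cong (q *_) (QP.*-inverseʳ r) ⟩
  q * 1ℚ             ≡⟨ QP.*-identityʳ q ⟩
  q                  ∎
  where
  open ≡-Reasoning
  instance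
    r-nonZero : NonZero r
    r-nonZero = ≢-nonZero r≢0

ratio-unique : ∀ {p a b} → a ≢ + 0 → p * fromℤ a ≡ fromℤ b → p ≡ ratio b a
ratio-unique {a = a} {b} a≢0 pa≡b =
  *-cancelʳ-≡ (fromℤ a) (fromℤ-≢0 a≢0) (trans pa≡b (sym (ratio-*-denominator b a a≢0)))

IsSquare : ℚ → Set
IsSquare q = ∃[ r ] (0ℚ ≤ r × r * r ≡ q)

∣p∣*∣p∣≡p*p : ∀ p → ∣ p ∣ * ∣ p ∣ ≡ p * p
∣p∣*∣p∣≡p*p p with QP.∣p∣≡p∨∣p∣≡-p p
... | inj₁ ∣p∣≡p  rewrite ∣p∣≡p  = refl
... | inj₂ ∣p∣≡-p rewrite ∣p∣≡-p = solve 1 (λ x → (:- x) :* (:- x) := x :* x) refl p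

IsSquare-intro : ∀ r {q} → r * r ≡ q → IsSquare q
IsSquare-intro r r*r≡q = ∣ r ∣ , QP.0≤∣p∣ r , trans (∣p∣*∣p∣≡p*p r) r*r≡q

0<1+p*p : ∀ p → 0ℚ < 1ℚ + p * p
0<1+p*p p = QP.positive⁻¹ (1ℚ + p * p) {{QP.pos+nonNeg⇒pos 1ℚ (p * p) {{p*p-nonNeg}}}}
  where
  p*p-nonNeg : NonNegative (p * p)
  p*p-nonNeg = subst NonNegative (∣p∣*∣p∣≡p*p p)
    (QP.nonNeg*nonNeg⇒nonNeg (∣ p ∣) {{QP.∣-∣-nonNeg p}} (∣ p ∣) {{QP.∣-∣-nonNeg p}})

IsSquare-*-square⇔ : ∀ a q → a ≢ 0ℚ → IsSquare ((a * a) * q) ⇔ IsSquare q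
IsSquare-*-square⇔ a q a≢0 = mk⇔ divide multiply
  where
  open ≡-Reasoning
  instance
    a-nonZero : NonZero a
    a-nonZero = ≢-nonZero a≢0
  a⁻¹ : ℚ
  a⁻¹ = 1/ a
  divide : IsSquare ((a * a) * q) → IsSquare q
  divide (d , _ , d*d≡a*a*q) = IsSquare-intro (d * a⁻¹) (begin
    (d * a⁻¹) * (d * a⁻¹)              ≡⟨ solve 2 (λ d i → (d :* i) :* (d :* i) := (d :* d) :* (i :* i)) refl d a⁻¹ ⟩
    (d * d) * (a⁻¹ * a⁻¹)              ≡⟨ cong (_* (a⁻¹ * a⁻¹)) d*d≡a*a*q ⟩
    ((a * a) * q) * (a⁻¹ * a⁻¹)        ≡⟨ solve 3 (λ a q i → ((a :* a) :* q) :* (i :* i) := ((a :* i) :* (a :* i)) :* q) refl a q a⁻¹ ⟩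
    ((a * a⁻¹) * (a * a⁻¹)) * q        ≡⟨ cong (λ x → (x * x) * q) (QP.*-inverseʳ a) ⟩
    (1ℚ * 1ℚ) * q                      ≡⟨ QP.*-identityˡ q ⟩
    q                                  ∎)
  multiply : IsSquare q → IsSquare ((a * a) * q)
  multiply (r , _ , r*r≡q) = IsSquare-intro (a * r) (begin
    (a * r) * (a * r)   ≡⟨ solve 2 (λ a r → (a :* r) :* (a :* r) := (a :* a) :* (r :* r)) refl a r ⟩
    (a * a) * (r * r)   ≡⟨ cong ((a * a) *_) r*r≡q ⟩
    (a * a) * q         ∎)

pythagorean-divide-by-leg : ∀ {a b g s r} → a ≢ 0ℚ → s * a ≡ b → r * a ≡ g →
  a * a + b * b ≡ g * g → r * r ≡ 1ℚ + s * s
pythagorean-divide-by-leg {a} {b} {g} {s} {r} a≢0 s*a≡b r*a≡g pyth =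
  *-cancelʳ-≡ a a≢0 (*-cancelʳ-≡ a a≢0 (begin
    ((r * r) * a) * a            ≡⟨ solve 2 (λ r a → ((r :* r) :* a) :* a := (r :* a) :* (r :* a)) refl r a ⟩
    (r * a) * (r * a)            ≡⟨ cong (λ x → x * x) r*a≡g ⟩
    g * g                        ≡⟨ pyth ⟨
    a * a + b * b                ≡⟨ cong (λ x → a * a + x * x) s*a≡b ⟨
    a * a + (s * a) * (s * a)    ≡⟨ solve 2 (λ a s → a :* a :+ (s :* a) :* (s :* a) := ((con 1ℚ :+ s :* s) :* a) :* a) refl a s ⟩
    ((1ℚ + s * s) * a) * a       ∎))
  where open ≡-Reasoning

pythagorean-clear-denominators : ∀ {s r q m p n} → s * q ≡ p → r * m ≡ n → r * r ≡ 1ℚ + s * s →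
  (q * m) * (q * m) + (p * m) * (p * m) ≡ (n * q) * (n * q)
pythagorean-clear-denominators {s} {r} {q} {m} {p} {n} s*q≡p r*m≡n r*r≡1+s*s = begin
  (q * m) * (q * m) + (p * m) * (p * m)                  ≡⟨ cong (λ x → (q * m) * (q * m) + (x * m) * (x * m)) s*q≡p ⟨
  (q * m) * (q * m) + ((s * q) * m) * ((s * q) * m)      ≡⟨ solve 3 (λ s q m → (q :* m) :* (q :* m) :+ ((s :* q) :* m) :* ((s :* q) :* m) := (con 1ℚ :+ s :* s) :* ((q :* m) :* (q :* m))) refl s q m ⟩
  (1ℚ + s * s) * ((q * m) * (q * m))                     ≡⟨ cong (_* ((q * m) * (q * m))) r*r≡1+s*s ⟨
  (r * r) * ((q * m) * (q * m))                          ≡⟨ solve 3 (λ r q m → (r :* r) :* ((q :* m) :* (q :* m)) := ((r :* m) :* q) :* ((r :* m) :* q)) refl r q m ⟩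
  ((r * m) * q) * ((r * m) * q)                          ≡⟨ cong (λ x → (x * q) * (x * q)) r*m≡n ⟩
  (n * q) * (n * q)                                      ∎
  where open ≡-Reasoning

Ψ⇒IsSquare-1+s*s : ∀ s → Ψ s → IsSquare (1ℚ + s * s)
Ψ⇒IsSquare-1+s*s s (inj₁ refl)      = IsSquare-intro 1ℚ refl
Ψ⇒IsSquare-1+s*s s (inj₂ (t , refl)) = IsSquare-intro (ratio γ α)
  (pythagorean-divide-by-leg {s = ratio β α} {r = ratio γ α} (fromℤ-≢0 α≢0)
    (ratio-*-denominator β α α≢0) (ratio-*-denominator γ α α≢0)
    (to (fromℤ-pythagorean α β γ) pyth))
  where open PythagoreanTriplet t

-- Matching on s and r makes α and γ reduce to +[1+ _ ], so α ≢ 0 and γ > 0 hold by computation.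
triplet-of-1+s*s≡r*r : ∀ s r .{{_ : Positive r}} → s ≢ 0ℚ → r * r ≡ 1ℚ + s * s →
  Σ PythagoreanTriplet (λ t → s ≡ ratio (PythagoreanTriplet.β t) (PythagoreanTriplet.α t))
triplet-of-1+s*s≡r*r s@record{} r@(mkℚ +[1+ _ ] _ _) s≢0 r*r≡1+s*s = triplet , s≡ratio
  where
  open ≡-Reasoning
  α β γ : ℤ
  α = ↧ s ℤ.* ↧ r
  β = ↥ s ℤ.* ↧ r
  γ = ↥ r ℤ.* ↧ s
  pyth : α ℤ.* α ℤ.+ β ℤ.* β ≡ γ ℤ.* γ
  pyth = from (fromℤ-pythagorean α β γ) (begin
    fromℤ α * fromℤ α + fromℤ β * fromℤ β
      ≡⟨ cong₂ (λ x y → x * x + y * y) (fromℤ-homo-* (↧ s) (↧ r)) (fromℤ-homo-* (↥ s) (↧ r)) ⟩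
    (fromℤ (↧ s) * fromℤ (↧ r)) * (fromℤ (↧ s) * fromℤ (↧ r)) + (fromℤ (↥ s) * fromℤ (↧ r)) * (fromℤ (↥ s) * fromℤ (↧ r))
      ≡⟨ pythagorean-clear-denominators {s = s} {r = r} (*-denominator s) (*-denominator r) r*r≡1+s*s ⟩
    (fromℤ (↥ r) * fromℤ (↧ s)) * (fromℤ (↥ r) * fromℤ (↧ s))
      ≡⟨ cong (λ x → x * x) (fromℤ-homo-* (↥ r) (↧ s)) ⟨
    fromℤ γ * fromℤ γ ∎)
  β≢0 : β ≢ + 0
  β≢0 β≡0 with ℤP.i*j≡0⇒i≡0∨j≡0 (↥ s) β≡0
  ... | inj₁ ↥s≡0 = s≢0 (QP.↥p≡0⇒p≡0 s ↥s≡0)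
  ... | inj₂ ()
  triplet : PythagoreanTriplet
  triplet = record
    { α = α ; β = β ; γ = γ ; α≢0 = λ () ; β≢0 = β≢0 ; γ≢0 = λ ()
    ; γ>0 = ℤ.+<+ ℕ.z<s ; pyth = pyth }
  s≡ratio : s ≡ ratio β α
  s≡ratio = ratio-unique {a = α} {b = β} (λ ()) (begin
    s * fromℤ α                          ≡⟨ cong (s *_) (fromℤ-homo-* (↧ s) (↧ r)) ⟩
    s * (fromℤ (↧ s) * fromℤ (↧ r))      ≡⟨ QP.*-assoc s (fromℤ (↧ s)) (fromℤ (↧ r)) ⟨
    (s * fromℤ (↧ s)) * fromℤ (↧ r)      ≡⟨ cong (_* fromℤ (↧ r)) (*-denominator s) ⟩
    fromℤ (↥ s) * fromℤ (↧ r)            ≡⟨ fromℤ-homo-* (↥ s) (↧ r) ⟨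
    fromℤ β                              ∎)

IsSquare-1+s*s⇒Ψ : ∀ s → IsSquare (1ℚ + s * s) → Ψ s
IsSquare-1+s*s⇒Ψ s (r , 0≤r , r*r≡1+s*s) with s QP.≟ 0ℚ
... | yes s≡0 = inj₁ s≡0
... | no s≢0  = inj₂ (triplet-of-1+s*s≡r*r s r {{r-positive}} s≢0 r*r≡1+s*s)
  where
  r≢0 : r ≢ 0ℚ
  r≢0 r≡0 = QP.<-irrefl (trans (cong (λ x → x * x) (sym r≡0)) r*r≡1+s*s) (0<1+p*p s)
  r-positive : Positive r
  r-positive = QP.nonNeg∧nonZero⇒pos r {{nonNegative 0≤r}} {{≢-nonZero r≢0}}

IsSquare-1+s*s⇔Ψ : ∀ s → IsSquare (1ℚ + s * s) ⇔ Ψ s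
IsSquare-1+s*s⇔Ψ s = mk⇔ (IsSquare-1+s*s⇒Ψ s) (Ψ⇒IsSquare-1+s*s s)

sqDist-onParabola : ∀ x y →
  sqDist (onParabola x) (onParabola y) ≡ ((x - y) * (x - y)) * (1ℚ + (x + y) * (x + y))
sqDist-onParabola = solve 2 (λ x y →
  (x :- y) :* (x :- y) :+ (x :* x :- y :* y) :* (x :* x :- y :* y)
    := ((x :- y) :* (x :- y)) :* (con 1ℚ :+ (x :+ y) :* (x :+ y))) refl

lemma2p1 : (xi xj : ℚ) → xi ≢ xj →
    (RationalDistance (onParabola xi) (onParabola xj) ⇔ Ψ (xi + xj))
lemma2p1 xi xj xi≢xj =
  subst (λ q → IsSquare q ⇔ Ψ (xi + xj)) (sym (sqDist-onParabola xi xj))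
    (IsSquare-1+s*s⇔Ψ (xi + xj) ⇔-∘ IsSquare-*-square⇔ (xi - xj) _ xi-xj≢0)
  where
  xi-xj≢0 : xi - xj ≢ 0ℚ
  xi-xj≢0 = xi≢xj ∘ x∙y⁻¹≈ε⇒x≈y xi xj
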